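{- Let $p$ be an odd prime. For any two distinct integers $j,k\in\{1,2,\dots,(p-1)/2\}$, the square-free parts of $j(p-j)$ and $k(p-k)$ are distinct. -}

module Defs where

open import Data.Nat using (ℕ; _*_)
open import Data.Nat.Divisibility using (_∣_)
open import Data.Product using (Σ; _×_)
open import Relation.Binary.PropositionalEquality using (_≡_)

SquareFree : ℕ → Set
SquareFree n = (d : ℕ) → d * d ∣ n → d ≡ 1

IsSquareFreePart : ℕ → ℕ → Set
IsSquareFreePart s n = SquareFree s × Σ ℕ (λ m → n ≡ s * (m * m))

-- With u = p − 2j the relation j(p − j) = s a² reads u² + 4 s a² = p². Given a second such
-- relation v² + 4 s b² = p² with the same s, eliminating 4 s a² b² gives
-- (ub)² + p² a² = (va)² + p² b², so p² divides (va − ub)(va + ub). Both factors are below p²,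
-- and p cannot divide both, since it would then divide 2ub; hence ub = va, so a = b and u = v.
module Submission where

open import Defs
open import Data.Nat using (ℕ; _*_; _∸_; _/_; _≤_)
open import Data.Nat.Primality using (Prime)
open import Relation.Binary.PropositionalEquality using (_≡_; _≢_)

open import Data.Nat.Base using (zero; suc; _+_; _<_; s≤s; NonZero; z<s; >-nonZero; >-nonZero⁻¹; nonTrivial⇒n>1)
open import Data.Nat.Properties
open import Data.Nat.Divisibility
open import Data.Nat.DivMod using (m/n*n≤m)
open import Data.Nat.Primality using (euclidsLemma; prime⇒nonZero; prime⇒nonTrivial)
open import Data.Nat.Tactic.RingSolver using (solve-∀)
open import Data.Product using (_×_; _,_)
open import Data.Sum using (_⊎_; inj₁; inj₂)
open import Data.Empty using (⊥; ⊥-elim)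
open import Relation.Nullary using (¬_; contradiction)
open import Relation.Binary.Definitions using (tri<; tri≈; tri>)
open import Relation.Binary.PropositionalEquality using (refl; sym; trans; cong; cong₂; subst; module ≡-Reasoning)

private
  variable
    m n p s u v a b A B : ℕ

*-self-≤-reflect : m * m ≤ n * n → m ≤ n
*-self-≤-reflect {m} {n} m²≤n² with ≤-<-connex m n
... | inj₁ m≤n = m≤n
... | inj₂ n<m = contradiction m²≤n² (<⇒≱ (*-mono-< n<m n<m))

*-self-injective : m * m ≡ n * n → m ≡ n
*-self-injective eq = ≤-antisym (*-self-≤-reflect (≤-reflexive eq)) (*-self-≤-reflect (≤-reflexive (sym eq)))


prime∤2 : Prime p → p ≢ 2 → ¬ p ∣ 2
prime∤2 {p} pr p≢2 p∣2 = p≢2 (≤-antisym (∣⇒≤ p∣2) (nonTrivial⇒n>1 p {{prime⇒nonTrivial pr}}))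

prime∤2*m*n : Prime p → p ≢ 2 → 0 < m → m < p → 0 < n → n < p → ¬ p ∣ 2 * (m * n)
prime∤2*m*n {p} {m} {n} pr p≢2 0<m m<p 0<n n<p p∣2mn with euclidsLemma 2 (m * n) pr p∣2mn
... | inj₁ p∣2 = prime∤2 pr p≢2 p∣2
... | inj₂ p∣mn with euclidsLemma m n pr p∣mn
...   | inj₁ p∣m = >⇒∤ {{>-nonZero 0<m}} m<p p∣m
...   | inj₂ p∣n = >⇒∤ {{>-nonZero 0<n}} n<p p∣n

p∣m⇒p²∣m*n⇒p²∣m⊎p∣n : Prime p → p ∣ m → p * p ∣ m * n → p * p ∣ m ⊎ p ∣ n
p∣m⇒p²∣m*n⇒p²∣m⊎p∣n {p} {n = n} pr (divides q refl) p²∣qpn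
  with euclidsLemma q n pr (*-cancelˡ-∣ p {{prime⇒nonZero pr}} (subst (p * p ∣_) qpn≡p[qn] p²∣qpn))
  where
  qpn≡p[qn] : q * p * n ≡ p * (q * n)
  qpn≡p[qn] = trans (cong (_* n) (*-comm q p)) (*-assoc p q n)
... | inj₁ (divides r refl) = inj₁ (divides r (*-assoc r p p))
... | inj₂ p∣n = inj₂ p∣n

euclidsLemma² : ∀ m n → Prime p → p * p ∣ m * n → p * p ∣ m ⊎ p * p ∣ n ⊎ (p ∣ m × p ∣ n)
euclidsLemma² {p} m n pr p²∣mn with euclidsLemma m n pr (∣-trans (m∣m*n p) p²∣mn)
... | inj₁ p∣m with p∣m⇒p²∣m*n⇒p²∣m⊎p∣n pr p∣m p²∣mn
...   | inj₁ p²∣m = inj₁ p²∣m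
...   | inj₂ p∣n = inj₂ (inj₂ (p∣m , p∣n))
euclidsLemma² {p} m n pr p²∣mn | inj₂ p∣n
  with p∣m⇒p²∣m*n⇒p²∣m⊎p∣n pr p∣n (subst (p * p ∣_) (*-comm m n) p²∣mn)
...   | inj₁ p²∣n = inj₂ (inj₁ p²∣n)
...   | inj₂ p∣m = inj₂ (inj₂ (p∣m , p∣n))

squares-≢-mod-p² : Prime p → ¬ p ∣ 2 * m → m < n → m + n < p * p →
                   m * m + p * p * A ≢ n * n + p * p * B
squares-≢-mod-p² {p} {m} {n} {A} {B} pr p∤2m m<n m+n<p² eq with m≤n⇒∃[o]m+o≡n (<⇒≤ m<n)
... | d , refl = excluded (euclidsLemma² d (m + (m + d)) pr p²∣d[m+n])
  where
  square-expand : ∀ m d q b → (m + d) * (m + d) + q * b ≡ m * m + (q * b + d * (m + (m + d)))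
  square-expand = solve-∀
  sum-rearrange : ∀ m d → m + (m + d) ≡ d + 2 * m
  sum-rearrange = solve-∀
  p²∣d[m+n] : p * p ∣ d * (m + (m + d))
  p²∣d[m+n] = ∣m+n∣m⇒∣n
    (subst (p * p ∣_) (+-cancelˡ-≡ (m * m) _ _ (trans eq (square-expand m d (p * p) B))) (m∣m*n A))
    (m∣m*n B)
  0<d : 0 < d
  0<d = +-cancelˡ-< m 0 d (subst (_< m + d) (sym (+-identityʳ m)) m<n)
  d≤m+n : d ≤ m + (m + d)
  d≤m+n = ≤-trans (m≤n+m d m) (m≤n+m (m + d) m)
  excluded : p * p ∣ d ⊎ p * p ∣ m + (m + d) ⊎ (p ∣ d × p ∣ m + (m + d)) → ⊥
  excluded (inj₁ p²∣d) = <⇒≱ (≤-<-trans d≤m+n m+n<p²) (∣⇒≤ {{>-nonZero 0<d}} p²∣d)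
  excluded (inj₂ (inj₁ p²∣m+n)) = <⇒≱ m+n<p² (∣⇒≤ {{>-nonZero (<-≤-trans 0<d d≤m+n)}} p²∣m+n)
  excluded (inj₂ (inj₂ (p∣d , p∣m+n))) =
    p∤2m (∣m+n∣m⇒∣n (subst (p ∣_) (sum-rearrange m d) p∣m+n) p∣d)

squares-≡-mod-p²⇒≡ : Prime p → ¬ p ∣ 2 * m → ¬ p ∣ 2 * n → m + n < p * p →
                     m * m + p * p * A ≡ n * n + p * p * B → m ≡ n
squares-≡-mod-p²⇒≡ {p} {m} {n} pr p∤2m p∤2n m+n<p² eq with <-cmp m n
... | tri≈ _ m≡n _ = m≡n
... | tri< m<n _ _ = ⊥-elim (squares-≢-mod-p² pr p∤2m m<n m+n<p² eq)
... | tri> _ _ n<m =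
  ⊥-elim (squares-≢-mod-p² pr p∤2n n<m (subst (_< p * p) (+-comm m n) m+n<p²) (sym eq))

2*m≤n⇒m<n : 0 < m → 2 * m ≤ n → m < n
2*m≤n⇒m<n {m} 0<m 2m≤n = <-≤-trans (m<m+n m (≤-trans 0<m (m≤m+n m 0))) 2m≤n

2*m≤o⇒2*n≤o⇒m+n≤o : ∀ {o} → 2 * m ≤ o → 2 * n ≤ o → m + n ≤ o
2*m≤o⇒2*n≤o⇒m+n≤o {m} {n} {o} 2m≤o 2n≤o = *-cancelˡ-≤ 2 (begin
  2 * (m + n)   ≡⟨ *-distribˡ-+ 2 m n ⟩
  2 * m + 2 * n ≤⟨ +-mono-≤ 2m≤o 2n≤o ⟩
  o + o         ≡⟨ cong (o +_) (sym (+-identityʳ o)) ⟩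
  2 * o         ∎)
  where open ≤-Reasoning

m≤[n∸1]/2⇒2*m<n : 0 < n → m ≤ (n ∸ 1) / 2 → 2 * m < n
m≤[n∸1]/2⇒2*m<n {n = suc n} {m} _ m≤n/2 = s≤s (begin
  2 * m       ≤⟨ *-monoʳ-≤ 2 m≤n/2 ⟩
  2 * (n / 2) ≡⟨ *-comm 2 (n / 2) ⟩
  n / 2 * 2   ≤⟨ m/n*n≤m n 2 ⟩
  n           ∎)
  where open ≤-Reasoning

cross-products-< : u < p → v < p → 0 < a → 0 < b → a + b ≤ p → u * b + v * a < p * p
cross-products-< {u} {p} {v} {a} {b} u<p v<p 0<a 0<b a+b≤p = begin-strict
  u * b + v * a <⟨ +-mono-< (*-monoˡ-< b {{>-nonZero 0<b}} u<p)
                            (*-monoˡ-< a {{>-nonZero 0<a}} v<p) ⟩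
  p * b + p * a ≡⟨ *-distribˡ-+ p b a ⟨
  p * (b + a)   ≤⟨ *-monoʳ-≤ p (subst (_≤ p) (+-comm a b) a+b≤p) ⟩
  p * p         ∎
  where open ≤-Reasoning

pythagorean-form : ∀ {j} → 2 * j ≤ p → j * (p ∸ j) ≡ s * (a * a) →
                   (p ∸ 2 * j) * (p ∸ 2 * j) + 4 * s * (a * a) ≡ p * p
pythagorean-form {s = s} {a} {j} 2j≤p eq with m≤n⇒∃[o]m+o≡n 2j≤p
... | u , refl = begin
  (2 * j + u ∸ 2 * j) * (2 * j + u ∸ 2 * j) + 4 * s * (a * a)
    ≡⟨ cong₂ (λ x y → x * x + y) (m+n∸m≡n (2 * j) u) 4sa²≡4j[p∸j] ⟩
  u * u + 4 * (j * (2 * j + u ∸ j))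
    ≡⟨ cong (λ x → u * u + 4 * (j * x)) p∸j≡j+u ⟩
  u * u + 4 * (j * (j + u))
    ≡⟨ complete-square j u ⟩
  (2 * j + u) * (2 * j + u)
    ∎
  where
  open ≡-Reasoning
  reassociate : ∀ j u → 2 * j + u ≡ j + (j + u)
  reassociate = solve-∀
  complete-square : ∀ j u → u * u + 4 * (j * (j + u)) ≡ (2 * j + u) * (2 * j + u)
  complete-square = solve-∀
  p∸j≡j+u : 2 * j + u ∸ j ≡ j + u
  p∸j≡j+u = trans (cong (_∸ j) (reassociate j u)) (m+n∸m≡n j (j + u))
  4sa²≡4j[p∸j] : 4 * s * (a * a) ≡ 4 * (j * (2 * j + u ∸ j))
  4sa²≡4j[p∸j] = trans (*-assoc 4 s (a * a)) (cong (4 *_) (sym eq))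

pythagorean-leg-bounds : u < p → u * u + 4 * s * (a * a) ≡ p * p → 0 < a × 2 * a ≤ p
pythagorean-leg-bounds {u} {p} {zero} u<p eq =
  contradiction (*-self-injective {u} {p} (trans (sym (+-identityʳ (u * u))) eq)) (<⇒≢ u<p)
pythagorean-leg-bounds {u} {p} {suc s} {zero} u<p eq =
  contradiction (*-self-injective {u} {p} u²≡p²) (<⇒≢ u<p)
  where
  u²≡p² : u * u ≡ p * p
  u²≡p² = trans (sym (+-identityʳ (u * u))) (trans (cong (u * u +_) (sym (*-zeroʳ (4 * suc s)))) eq)
pythagorean-leg-bounds {u} {p} {s@(suc _)} {a@(suc _)} u<p eq = z<s , *-self-≤-reflect (begin
  2 * a * (2 * a)         ≡⟨ double-square a ⟩
  4 * (a * a)             ≤⟨ *-monoˡ-≤ (a * a) (m≤m*n 4 s) ⟩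
  4 * s * (a * a)         ≤⟨ m≤n+m _ (u * u) ⟩
  u * u + 4 * s * (a * a) ≡⟨ eq ⟩
  p * p                   ∎)
  where
  open ≤-Reasoning
  double-square : ∀ a → 2 * a * (2 * a) ≡ 4 * (a * a)
  double-square = solve-∀

pythagorean-leg-unique : Prime p → p ≢ 2 → 0 < u → u < p → 0 < v → v < p →
                         u * u + 4 * s * (a * a) ≡ p * p → v * v + 4 * s * (b * b) ≡ p * p → u ≡ v
pythagorean-leg-unique {p} {u} {v} {s} {a} {b} pr p≢2 0<u u<p 0<v v<p eu ev
  with pythagorean-leg-bounds {s = s} {a = a} u<p eu | pythagorean-leg-bounds {s = s} {a = b} v<p ev
... | 0<a , 2a≤p | 0<b , 2b≤p = *-cancelʳ-≡ u v b {{>-nonZero 0<b}} (trans ub≡va (cong (v *_) a≡b))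
  where
  eliminate-s : ∀ u v a b s → u * b * (u * b) + (v * v + 4 * s * (b * b)) * (a * a)
                             ≡ v * a * (v * a) + (u * u + 4 * s * (a * a)) * (b * b)
  eliminate-s = solve-∀
  open ≡-Reasoning
  cross : u * b * (u * b) + p * p * (a * a) ≡ v * a * (v * a) + p * p * (b * b)
  cross = begin
    u * b * (u * b) + p * p * (a * a)
      ≡⟨ cong (λ x → u * b * (u * b) + x * (a * a)) ev ⟨
    u * b * (u * b) + (v * v + 4 * s * (b * b)) * (a * a)
      ≡⟨ eliminate-s u v a b s ⟩
    v * a * (v * a) + (u * u + 4 * s * (a * a)) * (b * b)
      ≡⟨ cong (λ x → v * a * (v * a) + x * (b * b)) eu ⟩
    v * a * (v * a) + p * p * (b * b)
      ∎
  a<p : a < p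
  a<p = 2*m≤n⇒m<n 0<a 2a≤p
  b<p : b < p
  b<p = 2*m≤n⇒m<n 0<b 2b≤p
  ub≡va : u * b ≡ v * a
  ub≡va = squares-≡-mod-p²⇒≡ pr
            (prime∤2*m*n pr p≢2 0<u u<p 0<b b<p) (prime∤2*m*n pr p≢2 0<v v<p 0<a a<p)
            (cross-products-< u<p v<p 0<a 0<b (2*m≤o⇒2*n≤o⇒m+n≤o {a} {b} 2a≤p 2b≤p)) cross
  p≢0 : NonZero p
  p≢0 = prime⇒nonZero pr
  a≡b : a ≡ b
  a≡b = *-self-injective (*-cancelˡ-≡ (a * a) (b * b) (p * p) {{m*n≢0 p p {{p≢0}} {{p≢0}}}}
          (+-cancelˡ-≡ (u * b * (u * b)) _ _
            (trans cross (cong (λ x → x * x + p * p * (b * b)) (sym ub≡va)))))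

mainTheorem18 : (p : ℕ) → Prime p → p ≢ 2 →
    (j k : ℕ) → 1 ≤ j → j ≤ (p ∸ 1) / 2 → 1 ≤ k → k ≤ (p ∸ 1) / 2 → j ≢ k →
    (s t : ℕ) → IsSquareFreePart s (j * (p ∸ j)) → IsSquareFreePart t (k * (p ∸ k)) →
    s ≢ t
mainTheorem18 p pr p≢2 j k 0<j hj 0<k hk j≢k s .s (_ , a , ea) (_ , b , eb) refl =
  j≢k (*-cancelˡ-≡ j k 2 (∸-cancelˡ-≡ 2j≤p 2k≤p u≡v))
  where
  0<p : 0 < p
  0<p = >-nonZero⁻¹ p {{prime⇒nonZero pr}}
  2j<p : 2 * j < p
  2j<p = m≤[n∸1]/2⇒2*m<n 0<p hj
  2k<p : 2 * k < p
  2k<p = m≤[n∸1]/2⇒2*m<n 0<p hk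
  2j≤p : 2 * j ≤ p
  2j≤p = <⇒≤ 2j<p
  2k≤p : 2 * k ≤ p
  2k≤p = <⇒≤ 2k<p
  u≡v : p ∸ 2 * j ≡ p ∸ 2 * k
  u≡v = pythagorean-leg-unique {s = s} {a} {b} pr p≢2
          (m<n⇒0<n∸m 2j<p) (∸-monoʳ-< (*-monoʳ-< 2 0<j) 2j≤p)
          (m<n⇒0<n∸m 2k<p) (∸-monoʳ-< (*-monoʳ-< 2 0<k) 2k≤p)
          (pythagorean-form {s = s} {a} {j} 2j≤p ea) (pythagorean-form {s = s} {b} {k} 2k≤p eb)
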